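{- Let $n\in\mathbb{N}$ with $n\ge 2$. There exists a graph $G$ on $2n+4$ vertices such that for every field $\mathbb{F}$, \[ \mathrm{wcdim}(G,\mathbb{F})=\begin{cases}1 & \text{if } \mathrm{char}(\mathbb{F})\nmid (2n-1),\\ 2 & \text{if } \mathrm{char}(\mathbb{F})\mid (2n-1).\end{cases} \]
   Context: All graphs are finite, simple and undirected. An independent set is a set of pairwise non-adjacent vertices; it is maximal if not properly contained in another independent set. A well-covered weighting of a graph $G$ over a field $\mathbb{F}$ is a function $w:V(G)\to\mathbb{F}$ such that $\sum_{v\in M}w(v)$ is the same for all maximal independent sets $M$ of $G$. These form an $\mathbb{F}$-vector space, whose dimension is the well-covered dimension $\mathrm{wcdim}(G,\mathbb{F})$. Characteristic $0$ is regarded as not dividing the nonzero integer $2n-1$. -}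

module Defs where

open import Level using (Level; _⊔_; suc)
open import Agda.Primitive using (Setω)
open import Algebra.Bundles using (CommutativeRing)
open import Data.Nat as ℕ using (ℕ; zero)
open import Data.Nat.Divisibility using (_∣_)
open import Data.Fin using (Fin)
open import Data.Bool using (Bool; true; false; if_then_else_)
open import Data.Product using (Σ; ∃; _×_)
open import Relation.Nullary using (¬_)
open import Relation.Binary.PropositionalEquality using (_≡_)
open import Function.Bundles using (_⇔_)

record Field (c ℓ : Level) : Set (Level.suc (c ⊔ ℓ)) where
  field
    commutativeRing : CommutativeRing c ℓ
  open CommutativeRing commutativeRing public
  field
    1≉0     : ¬ (1# ≈ 0#)
    inverse : ∀ x → ¬ (x ≈ 0#) → Σ Carrier (λ y → x * y ≈ 1#)

module _ {c ℓ : Level} (F : Field c ℓ) where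
  open Field F

  _·1 : ℕ → Carrier
  zero ·1      = 0#
  (ℕ.suc m) ·1 = 1# + (m ·1)

  -- p is the characteristic of F: the kernel of ℤ → F (restricted to ℕ)
  -- is exactly pℤ, i.e. m·1 = 0 iff p ∣ m.  (p = 0 means characteristic 0.)
  IsCharacteristic : ℕ → Set ℓ
  IsCharacteristic p = ∀ m → (m ·1 ≈ 0#) ⇔ (p ∣ m)

  Σ[_] : ∀ {N} → (Fin N → Carrier) → Carrier
  Σ[_] {zero}    f = 0#
  Σ[_] {ℕ.suc N} f = f Fin.zero + Σ[_] (λ i → f (Fin.suc i))

record Graph (N : ℕ) : Set where
  field
    Adj   : Fin N → Fin N → Bool
    sym   : ∀ u v → Adj u v ≡ Adj v u
    irrfl : ∀ v → Adj v v ≡ false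

VSet : ℕ → Set
VSet N = Fin N → Bool

_⊆_ : ∀ {N} → VSet N → VSet N → Set
S ⊆ T = ∀ v → S v ≡ true → T v ≡ true

module _ {N : ℕ} (G : Graph N) where
  open Graph G

  IsIndependent : VSet N → Set
  IsIndependent S = ∀ u v → S u ≡ true → S v ≡ true → Adj u v ≡ false

  IsMaximalIndependent : VSet N → Set
  IsMaximalIndependent S =
    IsIndependent S × (∀ T → IsIndependent T → S ⊆ T → T ⊆ S)

module _ {c ℓ : Level} (F : Field c ℓ) {N : ℕ} (G : Graph N) where
  open Field F

  Weighting : Set c
  Weighting = Fin N → Carrier

  weightOf : Weighting → VSet N → Carrier
  weightOf w S = Σ[_] F (λ v → if S v then w v else 0#)

  IsWellCovered : Weighting → Set ℓ
  IsWellCovered w = ∀ M M' → IsMaximalIndependent G M → IsMaximalIndependent G M'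
                    → weightOf w M ≈ weightOf w M'

  lincomb : ∀ {d} → (Fin d → Carrier) → (Fin d → Weighting) → Weighting
  lincomb a b v = Σ[_] F (λ i → a i * b i v)

  -- The vector space of well-covered weightings (a subspace of F^N) has a
  -- basis of size d, i.e. wcdim(G, F) = d.
  WcDim : ℕ → Set (c ⊔ ℓ)
  WcDim d = Σ (Fin d → Weighting) λ b →
      (∀ i → IsWellCovered (b i))
    × (∀ a → (∀ v → lincomb a b v ≈ 0#) → ∀ i → a i ≈ 0#)
    × (∀ w → IsWellCovered w → Σ (Fin d → Carrier) λ a → ∀ v → w v ≈ lincomb a b v)

-- existential quantifier over graphs whose body is Setω (it quantifies
-- over fields at all universe levels)
record ∃Graph (N : ℕ) (P : Graph N → Setω) : Setω where
  constructor _,_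
  field
    graph    : Graph N
    property : P graph

module Submission where

-- The maximal independent sets of G are exactly six
--    shapes  {aᵢ, bᵢ}, {aᵢ, d₁, d₂}, B ∪ {c₁}, B ∪ {c₂}, {c₁, d₁}, {c₂, d₂}.
--  * Linear algebra.  A weighting is well-covered iff the six shapes have
--    equal weight.  Solving these equations, the well-covered weightings are
--    exactly c β₀ + d β₁ with (2n - 1) d = 0, where β₀ is 1 on A ∪ {c₁, c₂}
--    and β₁ is -1 on A, 2 on B and 1 on d₁, d₂ (both 0 elsewhere).
--  * Hence β₀ is a basis when 2n - 1 ≠ 0 in F, and β₀, β₁ is a basis when
--    2n - 1 = 0 in F, which is exactly when char F divides 2n - 1.

open import Defs
open import Level using (Level)
open import Data.Nat as ℕ using (ℕ; zero; suc)
import Data.Nat.Properties as ℕ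
open import Data.Fin using (Fin; zero; suc; _↑ˡ_; _↑ʳ_; splitAt; join; cast)
open import Data.Fin.Properties using (_≟_; any?; toℕ-injective; toℕ-cast; toℕ-↑ˡ; splitAt-↑ˡ; splitAt-↑ʳ; join-splitAt)
open import Data.Bool using (Bool; true; false; not; _∧_; _∨_; if_then_else_)
open import Data.Bool.Properties using (∨-comm; ∧-zeroʳ; ∧-identityʳ; ¬-not) renaming (_≟_ to _≟ᵇ_)
open import Data.Sum using (_⊎_; inj₁; inj₂; [_,_]′)
open import Data.Product using (Σ; ∃-syntax; _×_; _,_; proj₁; proj₂)
open import Data.Empty using (⊥-elim)
open import Relation.Nullary using (¬_; yes; no; does; contradiction)
open import Relation.Nullary.Decidable using (dec-true; dec-false; _×-dec_)
open import Relation.Binary.PropositionalEquality using (_≡_; _≢_; _≗_; refl; sym; trans; cong; cong₂; subst; subst₂; ≢-sym)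
open import Function.Bundles using (Equivalence)

module _ {N : ℕ} (G : Graph N) where
  open Graph G renaming (sym to Adj-sym)

  Dominating : VSet N → Set
  Dominating S = ∀ u → S u ≡ false → ∃[ v ] (S v ≡ true × Adj u v ≡ true)

  insert : Fin N → VSet N → VSet N
  insert u S v = does (v ≟ u) ∨ S v

  insert-elim : ∀ {u S v} → insert u S v ≡ true → v ≡ u ⊎ S v ≡ true
  insert-elim {u} {S} {v} v∈ with v ≟ u
  ... | yes v≡u = inj₁ v≡u
  ... | no _    = inj₂ v∈

  insert-independent : ∀ {u S} → IsIndependent G S →
    (∀ v → S v ≡ true → Adj u v ≡ false) → IsIndependent G (insert u S)
  insert-independent {u} {S} indep isolated p r p∈ r∈
    with insert-elim {u} {S} p∈ | insert-elim {u} {S} r∈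
  ... | inj₁ refl | inj₁ refl = irrfl u
  ... | inj₁ refl | inj₂ r∈S  = isolated r r∈S
  ... | inj₂ p∈S  | inj₁ refl = trans (Adj-sym p u) (isolated p p∈S)
  ... | inj₂ p∈S  | inj₂ r∈S  = indep p r p∈S r∈S

  -- if u ∉ S had no neighbour in S, then S ∪ {u} would be a larger
  -- independent set
  maximal⇒dominating : ∀ {S} → IsMaximalIndependent G S → Dominating S
  maximal⇒dominating {S} (indep , maximal) u u∉S
    with any? (λ v → (S v ≟ᵇ true) ×-dec (Adj u v ≟ᵇ true))
  ... | yes neighbour = neighbour
  ... | no  isolated  = contradiction (trans (sym u∈S) u∉S) λ ()
    where
    no-neighbour : ∀ v → S v ≡ true → Adj u v ≡ false
    no-neighbour v v∈S = ¬-not (λ uv → isolated (v , v∈S , uv))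
    S⊆insert : S ⊆ insert u S
    S⊆insert v v∈S with does (v ≟ u)
    ... | true  = refl
    ... | false = v∈S
    u∈S : S u ≡ true
    u∈S = maximal (insert u S) (insert-independent indep no-neighbour) S⊆insert u
            (cong (_∨ S u) (dec-true (u ≟ u) refl))

  -- a vertex of T ⊇ S outside S would have a neighbour in S ⊆ T
  dominating⇒maximal : ∀ {S} → IsIndependent G S → Dominating S → IsMaximalIndependent G S
  dominating⇒maximal {S} indep dom = indep , maximal
    where
    maximal : ∀ T → IsIndependent G T → S ⊆ T → T ⊆ S
    maximal T T-indep S⊆T v v∈T with S v in e
    ... | true  = refl
    ... | false with dom v e
    ...   | w , w∈S , vw = contradiction (trans (sym vw) (T-indep v w v∈T (S⊆T w w∈S))) λ ()

module Transport {V : Set} (_~_ : V → V → Bool)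
                 (~-sym : ∀ x y → x ~ y ≡ y ~ x) (~-irrefl : ∀ x → x ~ x ≡ false)
                 {N : ℕ} (enc : V → Fin N) (dec : Fin N → V)
                 (dec-enc : ∀ x → dec (enc x) ≡ x) (enc-dec : ∀ v → enc (dec v) ≡ v) where

  graph : Graph N
  graph = record { Adj   = λ u v → dec u ~ dec v
                 ; sym   = λ u v → ~-sym (dec u) (dec v)
                 ; irrfl = λ v → ~-irrefl (dec v) }

  IndependentV : (V → Bool) → Set
  IndependentV P = ∀ x y → P x ≡ true → P y ≡ true → x ~ y ≡ false

  DominatingV : (V → Bool) → Set
  DominatingV P = ∀ x → P x ≡ false → ∃[ y ] (P y ≡ true × x ~ y ≡ true)

  maximal⇒V : ∀ {M} → IsMaximalIndependent graph M →
              IndependentV (λ x → M (enc x)) × DominatingV (λ x → M (enc x))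
  maximal⇒V {M} mis@(indep , _) = indepV , domV
    where
    indepV : IndependentV (λ x → M (enc x))
    indepV x y x∈ y∈ = subst₂ (λ s t → s ~ t ≡ false) (dec-enc x) (dec-enc y)
                               (indep (enc x) (enc y) x∈ y∈)
    domV : DominatingV (λ x → M (enc x))
    domV x x∉ with maximal⇒dominating graph mis (enc x) x∉
    ... | v , v∈ , xv = dec v , subst (λ u → M u ≡ true) (sym (enc-dec v)) v∈
                              , subst (λ s → s ~ dec v ≡ true) (dec-enc x) xv

  V⇒maximal : ∀ {P} → IndependentV P → DominatingV P → IsMaximalIndependent graph (λ v → P (dec v))
  V⇒maximal {P} indepV domV = dominating⇒maximal graph indep dom
    where
    indep : IsIndependent graph (λ v → P (dec v))
    indep u v = indepV (dec u) (dec v)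
    dom : Dominating graph (λ v → P (dec v))
    dom u u∉ with domV (dec u) u∉
    ... | y , y∈ , uy = enc y , subst (λ x → P x ≡ true) (sym (dec-enc y)) y∈
                              , subst (λ x → dec u ~ x ≡ true) (sym (dec-enc y)) uy

module FieldFacts {c ℓ : Level} (F : Field c ℓ) where
  open Field F hiding (zero) renaming (refl to ≈-refl; sym to ≈-sym; trans to ≈-trans)
  open import Relation.Binary.Reasoning.Setoid setoid
  open import Algebra.Properties.Group +-group public
    using () renaming (∙-cancelˡ to +-cancelˡ; ∙-cancelʳ to +-cancelʳ; ε⁻¹≈ε to -0≈0)

  ι : ℕ → Carrier
  ι = _·1 F

  ∑ : ∀ {k} → (Fin k → Carrier) → Carrier
  ∑ = Σ[_] F

  ∑-cong : ∀ {k} {f g : Fin k → Carrier} → (∀ i → f i ≈ g i) → ∑ f ≈ ∑ g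
  ∑-cong {zero}  f≈g = ≈-refl
  ∑-cong {suc k} f≈g = +-cong (f≈g zero) (∑-cong (λ i → f≈g (suc i)))

  ∑-zero : ∀ k → ∑ {k} (λ _ → 0#) ≈ 0#
  ∑-zero zero    = ≈-refl
  ∑-zero (suc k) = ≈-trans (+-identityˡ _) (∑-zero k)

  ∑-const : ∀ k x → ∑ {k} (λ _ → x) ≈ ι k * x
  ∑-const zero    x = ≈-sym (zeroˡ x)
  ∑-const (suc k) x = begin
    x + ∑ {k} (λ _ → x)  ≈⟨ +-cong (≈-sym (*-identityˡ x)) (∑-const k x) ⟩
    1# * x + ι k * x     ≈⟨ distribʳ x 1# (ι k) ⟨
    (1# + ι k) * x       ∎

  ∑-indicator : ∀ {k} (i : Fin k) (f : Fin k → Carrier) →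
                ∑ (λ j → if does (j ≟ i) then f j else 0#) ≈ f i
  ∑-indicator {suc k} zero    f = ≈-trans (+-congˡ (∑-zero k)) (+-identityʳ (f zero))
  ∑-indicator {suc k} (suc i) f = ≈-trans (+-identityˡ _) (∑-indicator i (λ j → f (suc j)))

  ∑-split : ∀ p k (f : Fin (p ℕ.+ k) → Carrier) →
            ∑ f ≈ ∑ (λ i → f (i ↑ˡ k)) + ∑ (λ j → f (p ↑ʳ j))
  ∑-split zero    k f = ≈-sym (+-identityˡ _)
  ∑-split (suc p) k f = ≈-trans (+-congˡ (∑-split p k (λ i → f (suc i)))) (≈-sym (+-assoc _ _ _))

  ι-+ : ∀ p k → ι (p ℕ.+ k) ≈ ι p + ι k
  ι-+ zero    k = ≈-sym (+-identityˡ _)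
  ι-+ (suc p) k = ≈-trans (+-congˡ (ι-+ p k)) (≈-sym (+-assoc _ _ _))

  doubling : ∀ m d → ι (suc m) * (d + d) ≈ d + ι (2 ℕ.* suc m ℕ.∸ 1) * d
  doubling m d = begin
    ι n * (d + d)           ≈⟨ distribˡ (ι n) d d ⟩
    ι n * d + ι n * d       ≈⟨ distribʳ d (ι n) (ι n) ⟨
    (ι n + ι n) * d         ≈⟨ *-congʳ ι[2n]≈ ⟨
    (1# + ι q) * d          ≈⟨ distribʳ d 1# (ι q) ⟩
    1# * d + ι q * d        ≈⟨ +-congʳ (*-identityˡ d) ⟩
    d + ι q * d             ∎
    where
    n = suc m
    q = 2 ℕ.* n ℕ.∸ 1
    ι[2n]≈ : ι (2 ℕ.* n) ≈ ι n + ι n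
    ι[2n]≈ = ≈-trans (ι-+ n (n ℕ.+ 0)) (+-congˡ (reflexive (cong ι (ℕ.+-identityʳ n))))

  nonzero-cancel : ∀ {x y} → ¬ (x ≈ 0#) → x * y ≈ 0# → y ≈ 0#
  nonzero-cancel {x} {y} x≉0 xy≈0 with inverse x x≉0
  ... | x⁻¹ , xx⁻¹≈1 = begin
    y               ≈⟨ *-identityˡ y ⟨
    1# * y          ≈⟨ *-congʳ (≈-trans (≈-sym xx⁻¹≈1) (*-comm x x⁻¹)) ⟩
    (x⁻¹ * x) * y   ≈⟨ *-assoc x⁻¹ x y ⟩
    x⁻¹ * (x * y)   ≈⟨ *-congˡ xy≈0 ⟩
    x⁻¹ * 0#        ≈⟨ zeroʳ x⁻¹ ⟩
    0#              ∎

-- The graph of the theorem, for n = m + 1.  Its vertices are two copies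
-- a₀ … aₙ₋₁ and b₀ … bₙ₋₁ of the index set together with c₁, c₂, d₁, d₂;
-- the a's form a clique, aᵢ ~ bⱼ for i ≠ j, every a is adjacent to c₁ and
-- c₂, every b to d₁ and d₂, and finally c₁ ~ c₂, c₁ ~ d₂, c₂ ~ d₁.

module Construction (m : ℕ) where

  n : ℕ
  n = suc m

  data V : Set where
    a b         : Fin n → V
    c₁ c₂ d₁ d₂ : V

  _≢ᵇ_ : Fin n → Fin n → Bool
  i ≢ᵇ j = not (does (i ≟ j))

  ≢ᵇ-refl : ∀ i → (i ≢ᵇ i) ≡ false
  ≢ᵇ-refl i = cong not (dec-true (i ≟ i) refl)

  ≢ᵇ-true : ∀ {i j} → i ≢ j → (i ≢ᵇ j) ≡ true
  ≢ᵇ-true {i} {j} i≢j = cong not (dec-false (i ≟ j) i≢j)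

  -- each edge listed in (at least) one direction
  edge : V → V → Bool
  edge (a i) (a j) = i ≢ᵇ j
  edge (a i) (b j) = i ≢ᵇ j
  edge (a _) c₁    = true
  edge (a _) c₂    = true
  edge (b _) d₁    = true
  edge (b _) d₂    = true
  edge c₁    c₂    = true
  edge c₁    d₂    = true
  edge c₂    d₁    = true
  edge _     _     = false

  _~_ : V → V → Bool
  x ~ y = edge x y ∨ edge y x

  ~-sym : ∀ x y → x ~ y ≡ y ~ x
  ~-sym x y = ∨-comm (edge x y) (edge y x)

  ~-irrefl : ∀ x → x ~ x ≡ false
  ~-irrefl (a i) = cong₂ _∨_ (≢ᵇ-refl i) (≢ᵇ-refl i)
  ~-irrefl (b _) = refl
  ~-irrefl c₁    = refl
  ~-irrefl c₂    = refl
  ~-irrefl d₁    = refl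
  ~-irrefl d₂    = refl

  a~a : ∀ {i j} → i ≢ j → a i ~ a j ≡ true
  a~a {i} {j} i≢j = cong (_∨ (j ≢ᵇ i)) (≢ᵇ-true i≢j)

  a~b : ∀ {i j} → i ≢ j → a i ~ b j ≡ true
  a~b i≢j = cong (_∨ false) (≢ᵇ-true i≢j)

  a≁b : ∀ i → a i ~ b i ≡ false
  a≁b i = cong (_∨ false) (≢ᵇ-refl i)

  -- Vertex numbering: Fin (2n + 4) = Fin n (the a's) + Fin (n + 0) (the b's)
  -- + Fin 4 (c₁, c₂, d₁, d₂), split with splitAt.

  N : ℕ
  N = 2 ℕ.* n ℕ.+ 4

  -- the b-block has size n + 0 (as 2n unfolds to n + (n + 0))
  unpad : Fin (n ℕ.+ 0) → Fin n
  unpad = cast (ℕ.+-identityʳ n)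

  unpad-↑ˡ : ∀ i → unpad (i ↑ˡ 0) ≡ i
  unpad-↑ˡ i = toℕ-injective (trans (toℕ-cast (ℕ.+-identityʳ n) (i ↑ˡ 0)) (toℕ-↑ˡ i 0))

  ↑ˡ-unpad : ∀ j → unpad j ↑ˡ 0 ≡ j
  ↑ˡ-unpad j = toℕ-injective (trans (toℕ-↑ˡ (unpad j) 0) (toℕ-cast (ℕ.+-identityʳ n) j))

  enc : V → Fin N
  enc (a i) = (i ↑ˡ (n ℕ.+ 0)) ↑ˡ 4
  enc (b i) = (n ↑ʳ (i ↑ˡ 0)) ↑ˡ 4
  enc c₁    = (2 ℕ.* n) ↑ʳ zero
  enc c₂    = (2 ℕ.* n) ↑ʳ suc zero
  enc d₁    = (2 ℕ.* n) ↑ʳ suc (suc zero)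
  enc d₂    = (2 ℕ.* n) ↑ʳ suc (suc (suc zero))

  corner : Fin 4 → V
  corner zero                   = c₁
  corner (suc zero)             = c₂
  corner (suc (suc zero))       = d₁
  corner (suc (suc (suc zero))) = d₂

  decAB : Fin n ⊎ Fin (n ℕ.+ 0) → V
  decAB (inj₁ i) = a i
  decAB (inj₂ j) = b (unpad j)

  decode : Fin (2 ℕ.* n) ⊎ Fin 4 → V
  decode = [ (λ u → decAB (splitAt n u)) , corner ]′

  dec : Fin N → V
  dec v = decode (splitAt (2 ℕ.* n) v)

  dec-enc : ∀ x → dec (enc x) ≡ x
  dec-enc (a i) rewrite splitAt-↑ˡ (2 ℕ.* n) (i ↑ˡ (n ℕ.+ 0)) 4
                      | splitAt-↑ˡ n i (n ℕ.+ 0) = refl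
  dec-enc (b i) rewrite splitAt-↑ˡ (2 ℕ.* n) (n ↑ʳ (i ↑ˡ 0)) 4
                      | splitAt-↑ʳ n (n ℕ.+ 0) (i ↑ˡ 0) = cong b (unpad-↑ˡ i)
  dec-enc c₁ rewrite splitAt-↑ʳ (2 ℕ.* n) 4 zero                   = refl
  dec-enc c₂ rewrite splitAt-↑ʳ (2 ℕ.* n) 4 (suc zero)             = refl
  dec-enc d₁ rewrite splitAt-↑ʳ (2 ℕ.* n) 4 (suc (suc zero))       = refl
  dec-enc d₂ rewrite splitAt-↑ʳ (2 ℕ.* n) 4 (suc (suc (suc zero))) = refl

  enc-decAB : ∀ s → enc (decAB s) ≡ join n (n ℕ.+ 0) s ↑ˡ 4
  enc-decAB (inj₁ i) = refl
  enc-decAB (inj₂ j) = cong (λ k → (n ↑ʳ k) ↑ˡ 4) (↑ˡ-unpad j)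

  enc-decode : ∀ s → enc (decode s) ≡ join (2 ℕ.* n) 4 s
  enc-decode (inj₁ u) = trans (enc-decAB (splitAt n u)) (cong (_↑ˡ 4) (join-splitAt n (n ℕ.+ 0) u))
  enc-decode (inj₂ zero)                   = refl
  enc-decode (inj₂ (suc zero))             = refl
  enc-decode (inj₂ (suc (suc zero)))       = refl
  enc-decode (inj₂ (suc (suc (suc zero)))) = refl

  enc-dec : ∀ v → enc (dec v) ≡ v
  enc-dec v = trans (enc-decode (splitAt (2 ℕ.* n) v)) (join-splitAt (2 ℕ.* n) 4 v)

  open Transport _~_ ~-sym ~-irrefl enc dec dec-enc enc-dec public

module Shapes (m : ℕ) where
  open Construction m

  data Shape : Set where
    ab ad             : Fin n → Shape
    Bc₁ Bc₂ c₁d₁ c₂d₂ : Shape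

  ⟦_⟧ : Shape → V → Bool
  ⟦ ab i ⟧ (a j) = does (j ≟ i)
  ⟦ ab i ⟧ (b j) = does (j ≟ i)
  ⟦ ab _ ⟧ _     = false
  ⟦ ad i ⟧ (a j) = does (j ≟ i)
  ⟦ ad _ ⟧ d₁    = true
  ⟦ ad _ ⟧ d₂    = true
  ⟦ ad _ ⟧ _     = false
  ⟦ Bc₁ ⟧  (b _) = true
  ⟦ Bc₁ ⟧  c₁    = true
  ⟦ Bc₁ ⟧  _     = false
  ⟦ Bc₂ ⟧  (b _) = true
  ⟦ Bc₂ ⟧  c₂    = true
  ⟦ Bc₂ ⟧  _     = false
  ⟦ c₁d₁ ⟧ c₁    = true
  ⟦ c₁d₁ ⟧ d₁    = true
  ⟦ c₁d₁ ⟧ _     = false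
  ⟦ c₂d₂ ⟧ c₂    = true
  ⟦ c₂d₂ ⟧ d₂    = true
  ⟦ c₂d₂ ⟧ _     = false

  ≟-true : ∀ (j i : Fin n) → does (j ≟ i) ≡ true → j ≡ i
  ≟-true j i p with j ≟ i
  ... | yes j≡i = j≡i
  ... | no  _   = contradiction p λ ()

  ≟-false : ∀ (j i : Fin n) → does (j ≟ i) ≡ false → j ≢ i
  ≟-false j i p with j ≟ i
  ... | yes _   = contradiction p λ ()
  ... | no  j≢i = j≢i

  ≟-refl : ∀ (i : Fin n) → does (i ≟ i) ≡ true
  ≟-refl i = dec-true (i ≟ i) refl

  none : ∀ {P : Fin n → Bool} → ¬ (∃[ i ] P i ≡ true) → ∀ i → P i ≡ false
  none no-witness i = ¬-not (λ Pi → no-witness (i , Pi))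

  -- The tables run over pairs of members;
  -- pairs involving a non-member are refuted by the absurd pattern on the
  -- membership proof, and members aⱼ, bⱼ of ab i and ad i have j = i.

  ab-independent : ∀ i → IndependentV ⟦ ab i ⟧
  ab-independent i (a j) (a k) p q rewrite ≟-true j i p | ≟-true k i q = ~-irrefl (a i)
  ab-independent i (a j) (b k) p q rewrite ≟-true j i p | ≟-true k i q = a≁b i
  ab-independent i (b j) (a k) p q rewrite ≟-true j i p | ≟-true k i q = ≢ᵇ-refl i
  ab-independent i (b j) (b k) p q = refl
  ab-independent i (a j) c₁ p ()
  ab-independent i (a j) c₂ p ()
  ab-independent i (a j) d₁ p ()
  ab-independent i (a j) d₂ p ()
  ab-independent i (b j) c₁ p ()
  ab-independent i (b j) c₂ p ()
  ab-independent i (b j) d₁ p ()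
  ab-independent i (b j) d₂ p ()
  ab-independent i c₁ y () q
  ab-independent i c₂ y () q
  ab-independent i d₁ y () q
  ab-independent i d₂ y () q

  ad-independent : ∀ i → IndependentV ⟦ ad i ⟧
  ad-independent i (a j) (a k) p q rewrite ≟-true j i p | ≟-true k i q = ~-irrefl (a i)
  ad-independent i (a j) d₁ p q = refl
  ad-independent i (a j) d₂ p q = refl
  ad-independent i d₁ (a k) p q = refl
  ad-independent i d₁ d₁ p q = refl
  ad-independent i d₁ d₂ p q = refl
  ad-independent i d₂ (a k) p q = refl
  ad-independent i d₂ d₁ p q = refl
  ad-independent i d₂ d₂ p q = refl
  ad-independent i x (b k) p ()
  ad-independent i x c₁ p ()
  ad-independent i x c₂ p ()
  ad-independent i (b j) y () q
  ad-independent i c₁ y () q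
  ad-independent i c₂ y () q

  Bc₁-independent : IndependentV ⟦ Bc₁ ⟧
  Bc₁-independent (b j) (b k) p q = refl
  Bc₁-independent (b j) c₁ p q = refl
  Bc₁-independent c₁ (b k) p q = refl
  Bc₁-independent c₁ c₁ p q = refl
  Bc₁-independent x (a k) p ()
  Bc₁-independent x c₂ p ()
  Bc₁-independent x d₁ p ()
  Bc₁-independent x d₂ p ()
  Bc₁-independent (a j) y () q
  Bc₁-independent c₂ y () q
  Bc₁-independent d₁ y () q
  Bc₁-independent d₂ y () q

  Bc₂-independent : IndependentV ⟦ Bc₂ ⟧
  Bc₂-independent (b j) (b k) p q = refl
  Bc₂-independent (b j) c₂ p q = refl
  Bc₂-independent c₂ (b k) p q = refl
  Bc₂-independent c₂ c₂ p q = refl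
  Bc₂-independent x (a k) p ()
  Bc₂-independent x c₁ p ()
  Bc₂-independent x d₁ p ()
  Bc₂-independent x d₂ p ()
  Bc₂-independent (a j) y () q
  Bc₂-independent c₁ y () q
  Bc₂-independent d₁ y () q
  Bc₂-independent d₂ y () q

  c₁d₁-independent : IndependentV ⟦ c₁d₁ ⟧
  c₁d₁-independent c₁ c₁ p q = refl
  c₁d₁-independent c₁ d₁ p q = refl
  c₁d₁-independent d₁ c₁ p q = refl
  c₁d₁-independent d₁ d₁ p q = refl
  c₁d₁-independent x (a k) p ()
  c₁d₁-independent x (b k) p ()
  c₁d₁-independent x c₂ p ()
  c₁d₁-independent x d₂ p ()
  c₁d₁-independent (a j) y () q
  c₁d₁-independent (b j) y () q
  c₁d₁-independent c₂ y () q
  c₁d₁-independent d₂ y () q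

  c₂d₂-independent : IndependentV ⟦ c₂d₂ ⟧
  c₂d₂-independent c₂ c₂ p q = refl
  c₂d₂-independent c₂ d₂ p q = refl
  c₂d₂-independent d₂ c₂ p q = refl
  c₂d₂-independent d₂ d₂ p q = refl
  c₂d₂-independent x (a k) p ()
  c₂d₂-independent x (b k) p ()
  c₂d₂-independent x c₁ p ()
  c₂d₂-independent x d₁ p ()
  c₂d₂-independent (a j) y () q
  c₂d₂-independent (b j) y () q
  c₂d₂-independent c₁ y () q
  c₂d₂-independent d₁ y () q
  shape-independent : ∀ s → IndependentV ⟦ s ⟧
  shape-independent (ab i) = ab-independent i
  shape-independent (ad i) = ad-independent i
  shape-independent Bc₁    = Bc₁-independent
  shape-independent Bc₂    = Bc₂-independent
  shape-independent c₁d₁   = c₁d₁-independent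
  shape-independent c₂d₂   = c₂d₂-independent

  shape-dominating : ∀ s → DominatingV ⟦ s ⟧
  shape-dominating (ab i) (a j) e = a i , ≟-refl i , a~a (≟-false j i e)
  shape-dominating (ab i) (b j) e = a i , ≟-refl i , trans (~-sym (b j) (a i)) (a~b (≢-sym (≟-false j i e)))
  shape-dominating (ab i) c₁    e = a i , ≟-refl i , refl
  shape-dominating (ab i) c₂    e = a i , ≟-refl i , refl
  shape-dominating (ab i) d₁    e = b i , ≟-refl i , refl
  shape-dominating (ab i) d₂    e = b i , ≟-refl i , refl
  shape-dominating (ad i) (a j) e = a i , ≟-refl i , a~a (≟-false j i e)
  shape-dominating (ad i) (b j) e = d₁ , refl , refl
  shape-dominating (ad i) c₁    e = a i , ≟-refl i , refl
  shape-dominating (ad i) c₂    e = a i , ≟-refl i , refl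
  shape-dominating Bc₁ (a j) e = c₁ , refl , refl
  shape-dominating Bc₁ c₂    e = c₁ , refl , refl
  shape-dominating Bc₁ d₁    e = b zero , refl , refl
  shape-dominating Bc₁ d₂    e = c₁ , refl , refl
  shape-dominating Bc₂ (a j) e = c₂ , refl , refl
  shape-dominating Bc₂ c₁    e = c₂ , refl , refl
  shape-dominating Bc₂ d₁    e = c₂ , refl , refl
  shape-dominating Bc₂ d₂    e = b zero , refl , refl
  shape-dominating c₁d₁ (a j) e = c₁ , refl , refl
  shape-dominating c₁d₁ (b j) e = d₁ , refl , refl
  shape-dominating c₁d₁ c₂    e = c₁ , refl , refl
  shape-dominating c₁d₁ d₂    e = c₁ , refl , refl
  shape-dominating c₂d₂ (a j) e = c₂ , refl , refl
  shape-dominating c₂d₂ (b j) e = d₂ , refl , refl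
  shape-dominating c₂d₂ c₁    e = c₂ , refl , refl
  shape-dominating c₂d₂ d₁    e = c₂ , refl , refl

  -- The case split follows whether S meets A, then B, then {c₁}; in each case
  -- the membership of every other vertex is forced by independence
  -- ('excluded') or by domination ('forced').
  module Classify {S : V → Bool} (indep : IndependentV S) (dom : DominatingV S) where

    excluded : ∀ {x y} → S x ≡ true → x ~ y ≡ true → S y ≡ false
    excluded {x} {y} x∈ xy with S y in y∈
    ... | false = refl
    ... | true  = contradiction (trans (sym xy) (indep x y x∈ y∈)) λ ()

    dominated : ∀ x → S x ≡ false → ¬ (∀ y → x ~ y ≡ true → S y ≡ false)
    dominated x x∉ lonely with dom x x∉
    ... | y , y∈ , xy = contradiction (trans (sym y∈) (lonely y xy)) λ ()

    forced : ∀ x → (∀ y → x ~ y ≡ true → S y ≡ false) → S x ≡ true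
    forced x lonely with S x in x∈
    ... | true  = refl
    ... | false = ⊥-elim (dominated x x∈ lonely)

    Classified : Set
    Classified = Σ Shape λ s → S ≗ ⟦ s ⟧

    module MeetsA (i : Fin n) (aᵢ∈ : S (a i) ≡ true) where
      S-a : ∀ j → S (a j) ≡ does (j ≟ i)
      S-a j with j ≟ i
      ... | yes refl = aᵢ∈
      ... | no  j≢i  = excluded aᵢ∈ (a~a (≢-sym j≢i))

      S-b : ∀ {β} → S (b i) ≡ β → ∀ j → S (b j) ≡ does (j ≟ i) ∧ β
      S-b bᵢ j with j ≟ i
      ... | yes refl = bᵢ
      ... | no  j≢i  = excluded aᵢ∈ (a~b (≢-sym j≢i))

      c₁∉ : S c₁ ≡ false
      c₁∉ = excluded aᵢ∈ refl

      c₂∉ : S c₂ ≡ false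
      c₂∉ = excluded aᵢ∈ refl

      classified : Classified
      classified with S (b i) in bᵢ∈
      ... | true  = ab i , λ { (a j) → S-a j ; (b j) → trans (S-b bᵢ∈ j) (∧-identityʳ _)
                             ; c₁ → c₁∉ ; c₂ → c₂∉
                             ; d₁ → excluded bᵢ∈ refl ; d₂ → excluded bᵢ∈ refl }
      ... | false = ad i , λ { (a j) → S-a j ; (b j) → b∉ j ; c₁ → c₁∉ ; c₂ → c₂∉
                             ; d₁ → forced d₁ λ { (b k) _ → b∉ k ; c₂ _ → c₂∉ }
                             ; d₂ → forced d₂ λ { (b k) _ → b∉ k ; c₁ _ → c₁∉ } }
        where
        b∉ : ∀ j → S (b j) ≡ false
        b∉ j = trans (S-b bᵢ∈ j) (∧-zeroʳ _)

    module MeetsB (j : Fin n) (bⱼ∈ : S (b j) ≡ true) (a∉ : ∀ i → S (a i) ≡ false) where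
      d₁∉ : S d₁ ≡ false
      d₁∉ = excluded bⱼ∈ refl

      d₂∉ : S d₂ ≡ false
      d₂∉ = excluded bⱼ∈ refl

      b∈ : ∀ k → S (b k) ≡ true
      b∈ k = forced (b k) λ { (a l) _ → a∉ l ; d₁ _ → d₁∉ ; d₂ _ → d₂∉ }

      classified : Classified
      classified with S c₁ in c₁∈
      ... | true  = Bc₁ , λ { (a k) → a∉ k ; (b k) → b∈ k ; c₁ → c₁∈ ; c₂ → excluded c₁∈ refl
                            ; d₁ → d₁∉ ; d₂ → d₂∉ }
      ... | false = Bc₂ , λ { (a k) → a∉ k ; (b k) → b∈ k ; c₁ → c₁∈
                            ; c₂ → forced c₂ λ { (a k) _ → a∉ k ; c₁ _ → c₁∈ ; d₁ _ → d₁∉ }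
                            ; d₁ → d₁∉ ; d₂ → d₂∉ }

    avoidsAB : (∀ i → S (a i) ≡ false) → (∀ i → S (b i) ≡ false) → Classified
    avoidsAB a∉ b∉ with S c₁ in c₁∈
    ... | true  = c₁d₁ , λ { (a k) → a∉ k ; (b k) → b∉ k ; c₁ → c₁∈ ; c₂ → c₂∉
                           ; d₁ → forced d₁ λ { (b k) _ → b∉ k ; c₂ _ → c₂∉ } ; d₂ → excluded c₁∈ refl }
      where
      c₂∉ : S c₂ ≡ false
      c₂∉ = excluded c₁∈ refl
    ... | false = c₂d₂ , λ { (a k) → a∉ k ; (b k) → b∉ k ; c₁ → c₁∈ ; c₂ → c₂∈
                           ; d₁ → excluded c₂∈ refl ; d₂ → forced d₂ λ { (b k) _ → b∉ k ; c₁ _ → c₁∈ } }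
      where
      -- a₀ needs a neighbour in S, and c₂ is the only candidate left
      c₂∈ : S c₂ ≡ true
      c₂∈ with S c₂ in c₂∈
      ... | true  = refl
      ... | false = ⊥-elim (dominated (a zero) (a∉ zero)
                      λ { (a k) _ → a∉ k ; (b k) _ → b∉ k ; c₁ _ → c₁∈ ; c₂ _ → c₂∈ })

    classify : Classified
    classify with any? (λ i → S (a i) ≟ᵇ true) | any? (λ j → S (b j) ≟ᵇ true)
    ... | yes (i , aᵢ∈) | _             = MeetsA.classified i aᵢ∈
    ... | no  no-a      | yes (j , bⱼ∈) = MeetsB.classified j bⱼ∈ (none no-a)
    ... | no  no-a      | no  no-b      = avoidsAB (none no-a) (none no-b)

  shape-maximal : ∀ s → IsMaximalIndependent graph (λ v → ⟦ s ⟧ (dec v))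
  shape-maximal s = V⇒maximal (shape-independent s) (shape-dominating s)

  maximal-shape : ∀ {M} → IsMaximalIndependent graph M → Σ Shape λ s → ∀ v → M v ≡ ⟦ s ⟧ (dec v)
  maximal-shape {M} mis with maximal⇒V mis
  ... | indepV , domV with Classify.classify indepV domV
  ...   | s , M≗s = s , λ v → trans (cong M (sym (enc-dec v))) (M≗s (dec v))

module Weights {f ℓ : Level} (F : Field f ℓ) (m : ℕ) where
  open Field F hiding (zero) renaming (refl to ≈-refl; sym to ≈-sym; trans to ≈-trans)
  open FieldFacts F
  open Construction m
  open Shapes m
  open import Relation.Binary.Reasoning.Setoid setoid
  open import Algebra.Properties.Ring ring using (-‿distribʳ-*)

  ΣV : (V → Carrier) → Carrier
  ΣV u = ∑ (λ i → u (a i)) + (∑ (λ i → u (b i)) + ∑ (λ k → u (corner k)))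

  ΣV-cong : ∀ {u u′} → (∀ x → u x ≈ u′ x) → ΣV u ≈ ΣV u′
  ΣV-cong u≈ = +-cong (∑-cong (λ i → u≈ (a i)))
                      (+-cong (∑-cong (λ i → u≈ (b i))) (∑-cong (λ k → u≈ (corner k))))

  ∑-enc : ∀ (g : Fin N → Carrier) → ∑ g ≈ ΣV (λ x → g (enc x))
  ∑-enc g = begin
    ∑ g                                              ≈⟨ ∑-split (2 ℕ.* n) 4 g ⟩
    ∑ {2 ℕ.* n} (λ u → g (u ↑ˡ 4)) + C               ≈⟨ +-congʳ (∑-split n (n ℕ.+ 0) (λ u → g (u ↑ˡ 4))) ⟩
    (A + ∑ {n ℕ.+ 0} (λ j → g ((n ↑ʳ j) ↑ˡ 4))) + C  ≈⟨ +-congʳ (+-congˡ (∑-split n 0 (λ j → g ((n ↑ʳ j) ↑ˡ 4)))) ⟩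
    (A + (B + 0#)) + C                               ≈⟨ +-congʳ (+-congˡ (+-identityʳ B)) ⟩
    (A + B) + C                                      ≈⟨ +-assoc A B C ⟩
    A + (B + C)                                      ∎
    where
    A = ∑ (λ i → g (enc (a i)))
    B = ∑ (λ i → g (enc (b i)))
    C = ∑ (λ k → g (enc (corner k)))

  ⟪_⟫ : Shape → (V → Carrier) → Carrier
  ⟪ ab i ⟫ u = u (a i) + u (b i)
  ⟪ ad i ⟫ u = u (a i) + (u d₁ + u d₂)
  ⟪ Bc₁  ⟫ u = ∑ (λ j → u (b j)) + u c₁
  ⟪ Bc₂  ⟫ u = ∑ (λ j → u (b j)) + u c₂
  ⟪ c₁d₁ ⟫ u = u c₁ + u d₁
  ⟪ c₂d₂ ⟫ u = u c₂ + u d₂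

  ΣV-shape : ∀ s u → ΣV (λ x → if ⟦ s ⟧ x then u x else 0#) ≈ ⟪ s ⟫ u
  ΣV-shape (ab i) u = +-cong (∑-indicator i (λ j → u (a j)))
                             (≈-trans (+-cong (∑-indicator i (λ j → u (b j))) (∑-zero 4)) (+-identityʳ _))
  ΣV-shape (ad i) u = +-cong (∑-indicator i (λ j → u (a j))) (begin
    ∑ {n} (λ _ → 0#) + (0# + (0# + (u d₁ + (u d₂ + 0#))))  ≈⟨ +-congʳ (∑-zero n) ⟩
    0# + (0# + (0# + (u d₁ + (u d₂ + 0#))))               ≈⟨ ≈-trans (+-identityˡ _) (≈-trans (+-identityˡ _) (+-identityˡ _)) ⟩
    u d₁ + (u d₂ + 0#)                                     ≈⟨ +-congˡ (+-identityʳ _) ⟩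
    u d₁ + u d₂                                            ∎)
  ΣV-shape Bc₁ u = begin
    ∑ {n} (λ _ → 0#) + (B + (u c₁ + (0# + (0# + (0# + 0#)))))  ≈⟨ +-congʳ (∑-zero n) ⟩
    0# + (B + (u c₁ + ∑ {3} (λ _ → 0#)))                        ≈⟨ +-identityˡ _ ⟩
    B + (u c₁ + ∑ {3} (λ _ → 0#))                              ≈⟨ +-congˡ (≈-trans (+-congˡ (∑-zero 3)) (+-identityʳ _)) ⟩
    B + u c₁                                                   ∎
    where B = ∑ (λ j → u (b j))
  ΣV-shape Bc₂ u = begin
    ∑ {n} (λ _ → 0#) + (B + (0# + (u c₂ + (0# + (0# + 0#)))))  ≈⟨ +-congʳ (∑-zero n) ⟩
    0# + (B + (0# + (u c₂ + ∑ {2} (λ _ → 0#))))                 ≈⟨ +-identityˡ _ ⟩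
    B + (0# + (u c₂ + ∑ {2} (λ _ → 0#)))                        ≈⟨ +-congˡ (+-identityˡ _) ⟩
    B + (u c₂ + ∑ {2} (λ _ → 0#))                               ≈⟨ +-congˡ (≈-trans (+-congˡ (∑-zero 2)) (+-identityʳ _)) ⟩
    B + u c₂                                                   ∎
    where B = ∑ (λ j → u (b j))
  ΣV-shape c₁d₁ u = begin
    Z + (Z + (u c₁ + (0# + (u d₁ + (0# + 0#)))))  ≈⟨ ≈-trans (+-congʳ (∑-zero n)) (+-identityˡ _) ⟩
    Z + (u c₁ + (0# + (u d₁ + (0# + 0#))))        ≈⟨ ≈-trans (+-congʳ (∑-zero n)) (+-identityˡ _) ⟩
    u c₁ + (0# + (u d₁ + (0# + 0#)))              ≈⟨ +-congˡ (≈-trans (+-identityˡ _) (≈-trans (+-congˡ (+-identityʳ _)) (+-identityʳ _))) ⟩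
    u c₁ + u d₁                                   ∎
    where Z = ∑ {n} (λ _ → 0#)
  ΣV-shape c₂d₂ u = begin
    Z + (Z + (0# + (u c₂ + (0# + (u d₂ + 0#)))))  ≈⟨ ≈-trans (+-congʳ (∑-zero n)) (+-identityˡ _) ⟩
    Z + (0# + (u c₂ + (0# + (u d₂ + 0#))))        ≈⟨ ≈-trans (+-congʳ (∑-zero n)) (+-identityˡ _) ⟩
    0# + (u c₂ + (0# + (u d₂ + 0#)))              ≈⟨ +-identityˡ _ ⟩
    u c₂ + (0# + (u d₂ + 0#))                     ≈⟨ +-congˡ (≈-trans (+-identityˡ _) (+-identityʳ _)) ⟩
    u c₂ + u d₂                                   ∎
    where Z = ∑ {n} (λ _ → 0#)

  weight-shape : ∀ w u → (∀ x → w (enc x) ≈ u x) → ∀ s →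
                 weightOf F graph w (λ v → ⟦ s ⟧ (dec v)) ≈ ⟪ s ⟫ u
  weight-shape w u w≈u s =
    ≈-trans (∑-enc (λ v → if ⟦ s ⟧ (dec v) then w v else 0#)) (≈-trans (ΣV-cong pointwise) (ΣV-shape s u))
    where
    pointwise : ∀ x → (if ⟦ s ⟧ (dec (enc x)) then w (enc x) else 0#) ≈ (if ⟦ s ⟧ x then u x else 0#)
    pointwise x rewrite dec-enc x with ⟦ s ⟧ x
    ... | true  = w≈u x
    ... | false = ≈-refl

  wellCovered⇒balanced : ∀ {w} → IsWellCovered F graph w →
                         ∀ s t → ⟪ s ⟫ (λ x → w (enc x)) ≈ ⟪ t ⟫ (λ x → w (enc x))
  wellCovered⇒balanced {w} wc s t = begin
    ⟪ s ⟫ u                                 ≈⟨ weight-shape w u (λ _ → ≈-refl) s ⟨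
    weightOf F graph w (λ v → ⟦ s ⟧ (dec v)) ≈⟨ wc _ _ (shape-maximal s) (shape-maximal t) ⟩
    weightOf F graph w (λ v → ⟦ t ⟧ (dec v)) ≈⟨ weight-shape w u (λ _ → ≈-refl) t ⟩
    ⟪ t ⟫ u                                 ∎
    where u = λ x → w (enc x)

  balanced⇒wellCovered : ∀ {w} u κ → (∀ x → w (enc x) ≈ u x) → (∀ s → ⟪ s ⟫ u ≈ κ) →
                         IsWellCovered F graph w
  balanced⇒wellCovered {w} u κ w≈u balanced M M′ mis mis′ =
    ≈-trans (weight mis) (≈-sym (weight mis′))
    where
    weight : ∀ {M} → IsMaximalIndependent graph M → weightOf F graph w M ≈ κ
    weight {M} mis with maximal-shape mis
    ... | s , M≡s = ≈-trans (∑-cong (λ v → reflexive (cong (λ t → if t then w v else 0#) (M≡s v))))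
                             (≈-trans (weight-shape w u w≈u s) (balanced s))

  sol : Carrier → Carrier → V → Carrier
  sol c d (a _) = c - d
  sol c d (b _) = d + d
  sol c d c₁    = c
  sol c d c₂    = c
  sol c d d₁    = d
  sol c d d₂    = d

  sol-cong : ∀ {c c′ d d′} → c ≈ c′ → d ≈ d′ → ∀ x → sol c d x ≈ sol c′ d′ x
  sol-cong c≈ d≈ (a _) = +-cong c≈ (-‿cong d≈)
  sol-cong c≈ d≈ (b _) = +-cong d≈ d≈
  sol-cong c≈ d≈ c₁    = c≈
  sol-cong c≈ d≈ c₂    = c≈
  sol-cong c≈ d≈ d₁    = d≈
  sol-cong c≈ d≈ d₂    = d≈

  sol-linear : ∀ c d x → c * sol 1# 0# x + d * sol 0# 1# x ≈ sol c d x
  sol-linear c d (a _) = +-cong (≈-trans (*-congˡ 1-0≈1) (*-identityʳ c))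
                                (≈-trans (*-congˡ (+-identityˡ (- 1#)))
                                  (≈-trans (≈-sym (-‿distribʳ-* d 1#)) (-‿cong (*-identityʳ d))))
    where
    1-0≈1 : 1# - 0# ≈ 1#
    1-0≈1 = ≈-trans (+-congˡ -0≈0) (+-identityʳ 1#)
  sol-linear c d (b _) = begin
    c * (0# + 0#) + d * (1# + 1#)  ≈⟨ +-congʳ (≈-trans (*-congˡ (+-identityˡ 0#)) (zeroʳ c)) ⟩
    0# + d * (1# + 1#)             ≈⟨ +-identityˡ _ ⟩
    d * (1# + 1#)                  ≈⟨ distribˡ d 1# 1# ⟩
    d * 1# + d * 1#                ≈⟨ +-cong (*-identityʳ d) (*-identityʳ d) ⟩
    d + d                          ∎
  sol-linear c d c₁ = ≈-trans (+-cong (*-identityʳ c) (zeroʳ d)) (+-identityʳ c)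
  sol-linear c d c₂ = ≈-trans (+-cong (*-identityʳ c) (zeroʳ d)) (+-identityʳ c)
  sol-linear c d d₁ = ≈-trans (+-cong (zeroʳ c) (*-identityʳ d)) (+-identityˡ d)
  sol-linear c d d₂ = ≈-trans (+-cong (zeroʳ c) (*-identityʳ d)) (+-identityˡ d)

  q : ℕ
  q = 2 ℕ.* n ℕ.∸ 1

  -- the weight of B under sol c d, which is d exactly when (2n - 1) d = 0
  ∑-doubles : ∀ d → ∑ {n} (λ _ → d + d) ≈ d + ι q * d
  ∑-doubles d = ≈-trans (∑-const n (d + d)) (doubling m d)

  ∑-doubles≈ : ∀ {d} → ι q * d ≈ 0# → ∑ {n} (λ _ → d + d) ≈ d
  ∑-doubles≈ {d} qd = ≈-trans (∑-doubles d) (≈-trans (+-congˡ qd) (+-identityʳ d))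

  shift : ∀ c d → (c - d) + (d + d) ≈ c + d
  shift c d = begin
    (c - d) + (d + d)    ≈⟨ +-assoc c (- d) (d + d) ⟩
    c + (- d + (d + d))  ≈⟨ +-congˡ (+-assoc (- d) d d) ⟨
    c + ((- d + d) + d)  ≈⟨ +-congˡ (+-congʳ (-‿inverseˡ d)) ⟩
    c + (0# + d)         ≈⟨ +-congˡ (+-identityˡ d) ⟩
    c + d                ∎

  sol-balanced : ∀ {c d} → ι q * d ≈ 0# → ∀ s → ⟪ s ⟫ (sol c d) ≈ c + d
  sol-balanced {c} {d} qd (ab _) = shift c d
  sol-balanced {c} {d} qd (ad _) = shift c d
  sol-balanced {c} {d} qd Bc₁    = ≈-trans (+-congʳ (∑-doubles≈ qd)) (+-comm d c)
  sol-balanced {c} {d} qd Bc₂    = ≈-trans (+-congʳ (∑-doubles≈ qd)) (+-comm d c)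
  sol-balanced          qd c₁d₁  = ≈-refl
  sol-balanced          qd c₂d₂  = ≈-refl

  balanced⇒sol : ∀ u → (∀ s t → ⟪ s ⟫ u ≈ ⟪ t ⟫ u) →
                 ι q * u d₁ ≈ 0# × (∀ x → u x ≈ sol (u c₁) (u d₁) x)
  balanced⇒sol u balanced = q·d≈0 , u≈sol
    where
    c = u c₁
    d = u d₁
    B = ∑ (λ j → u (b j))
    c₂≈c : u c₂ ≈ c
    c₂≈c = +-cancelˡ B _ _ (balanced Bc₂ Bc₁)
    d₂≈d : u d₂ ≈ d
    d₂≈d = +-cancelˡ c _ _ (≈-trans (+-congʳ (≈-sym c₂≈c)) (balanced c₂d₂ c₁d₁))
    b≈ : ∀ i → u (b i) ≈ d + d
    b≈ i = ≈-trans (+-cancelˡ (u (a i)) _ _ (balanced (ab i) (ad i))) (+-congˡ d₂≈d)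
    B≈d : B ≈ d
    B≈d = +-cancelˡ c _ _ (≈-trans (+-comm c B) (balanced Bc₁ c₁d₁))
    q·d≈0 : ι q * d ≈ 0#
    q·d≈0 = +-cancelˡ d _ _ (begin
      d + ι q * d          ≈⟨ ∑-doubles d ⟨
      ∑ {n} (λ _ → d + d)  ≈⟨ ∑-cong b≈ ⟨
      B                    ≈⟨ B≈d ⟩
      d                    ≈⟨ +-identityʳ d ⟨
      d + 0#               ∎)
    a≈ : ∀ i → u (a i) ≈ c - d
    a≈ i = +-cancelʳ (d + d) _ _ (begin
      u (a i) + (d + d)  ≈⟨ +-congˡ (b≈ i) ⟨
      u (a i) + u (b i)  ≈⟨ balanced (ab i) c₁d₁ ⟩
      c + d              ≈⟨ shift c d ⟨
      (c - d) + (d + d)  ∎)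
    u≈sol : ∀ x → u x ≈ sol c d x
    u≈sol (a i) = a≈ i
    u≈sol (b i) = b≈ i
    u≈sol c₁    = ≈-refl
    u≈sol c₂    = c₂≈c
    u≈sol d₁    = ≈-refl
    u≈sol d₂    = d₂≈d

  lift : (V → Carrier) → Weighting F graph
  lift u v = u (dec v)

  sol-wellCovered : ∀ {c d} → ι q * d ≈ 0# → IsWellCovered F graph (lift (sol c d))
  sol-wellCovered {c} {d} qd =
    balanced⇒wellCovered {lift (sol c d)} (sol c d) (c + d) (λ x → reflexive (cong (sol c d) (dec-enc x))) (sol-balanced qd)

  wellCovered⇒sol : ∀ {w} → IsWellCovered F graph w →
                    ι q * w (enc d₁) ≈ 0# × (∀ v → w v ≈ lift (sol (w (enc c₁)) (w (enc d₁))) v)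
  wellCovered⇒sol {w} wc with balanced⇒sol (λ x → w (enc x)) (wellCovered⇒balanced {w} wc)
  ... | qd , w≈sol = qd , λ v → ≈-trans (reflexive (cong w (sym (enc-dec v)))) (w≈sol (dec v))

  sol-vanishes : ∀ {c d} {g : Weighting F graph} → (∀ v → g v ≈ lift (sol c d) v) →
                 (∀ v → g v ≈ 0#) → c ≈ 0# × d ≈ 0#
  sol-vanishes {c} {d} {g} g≈sol g≈0 = at c₁ , at d₁
    where
    at : ∀ x → sol c d x ≈ 0#
    at x = begin
      sol c d x              ≡⟨ cong (sol c d) (dec-enc x) ⟨
      lift (sol c d) (enc x) ≈⟨ g≈sol (enc x) ⟨
      g (enc x)              ≈⟨ g≈0 (enc x) ⟩
      0#                     ∎

  β₀ β₁ : Weighting F graph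
  β₀ = lift (sol 1# 0#)
  β₁ = lift (sol 0# 1#)

  dim1 : ¬ (ι q ≈ 0#) → WcDim F graph 1
  dim1 q≉0 = (λ _ → β₀) , (λ _ → sol-wellCovered (zeroʳ (ι q))) , independent , spanning
    where
    combination : ∀ α v → lincomb F graph α (λ _ → β₀) v ≈ lift (sol (α zero) 0#) v
    combination α v = begin
      α zero * β₀ v + 0#             ≈⟨ +-congˡ (zeroˡ (β₁ v)) ⟨
      α zero * β₀ v + 0# * β₁ v      ≈⟨ sol-linear (α zero) 0# (dec v) ⟩
      lift (sol (α zero) 0#) v       ∎
    independent : ∀ α → (∀ v → lincomb F graph α (λ _ → β₀) v ≈ 0#) → ∀ i → α i ≈ 0#
    independent α α≈0 zero = proj₁ (sol-vanishes (combination α) α≈0)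
    spanning : ∀ w → IsWellCovered F graph w →
               Σ (Fin 1 → Carrier) λ α → ∀ v → w v ≈ lincomb F graph α (λ _ → β₀) v
    spanning w wc with wellCovered⇒sol wc
    ... | qd , w≈sol = (λ _ → w (enc c₁)) , λ v →
      ≈-trans (w≈sol v) (≈-trans (sol-cong ≈-refl (nonzero-cancel q≉0 qd) (dec v))
                                 (≈-sym (combination (λ _ → w (enc c₁)) v)))

  dim2 : ι q ≈ 0# → WcDim F graph 2
  dim2 q≈0 = basis , wellCovered , independent , spanning
    where
    basis : Fin 2 → Weighting F graph
    basis zero       = β₀
    basis (suc zero) = β₁
    wellCovered : ∀ i → IsWellCovered F graph (basis i)
    wellCovered zero       = sol-wellCovered (zeroʳ (ι q))
    wellCovered (suc zero) = sol-wellCovered (≈-trans (*-identityʳ (ι q)) q≈0)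
    combination : ∀ α v → lincomb F graph α basis v ≈ lift (sol (α zero) (α (suc zero))) v
    combination α v = ≈-trans (+-congˡ (+-identityʳ _)) (sol-linear (α zero) (α (suc zero)) (dec v))
    independent : ∀ α → (∀ v → lincomb F graph α basis v ≈ 0#) → ∀ i → α i ≈ 0#
    independent α α≈0 zero       = proj₁ (sol-vanishes (combination α) α≈0)
    independent α α≈0 (suc zero) = proj₂ (sol-vanishes (combination α) α≈0)
    spanning : ∀ w → IsWellCovered F graph w →
               Σ (Fin 2 → Carrier) λ α → ∀ v → w v ≈ lincomb F graph α basis v
    spanning w wc with wellCovered⇒sol wc
    ... | _ , w≈sol = α , λ v → ≈-trans (w≈sol v) (≈-sym (combination α v))
      where
      α : Fin 2 → Carrier
      α zero       = w (enc c₁)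
      α (suc zero) = w (enc d₁)

-- ℕ arithmetic is opened unqualified only here, after the field modules
-- that use + and * for the field operations.
open import Data.Nat using (_+_; _*_; _∸_; _≥_; s≤s)
open import Data.Nat.Divisibility using (_∣_)

construction-wcdim : ∀ m {f ℓ : Level} (F : Field f ℓ) (p : ℕ) → IsCharacteristic F p →
  (¬ (p ∣ (2 * suc m ∸ 1)) → WcDim F (Construction.graph m) 1) ×
  (p ∣ (2 * suc m ∸ 1) → WcDim F (Construction.graph m) 2)
construction-wcdim m F p char =
  (λ p∤q → dim1 (λ q≈0 → p∤q (Equivalence.to (char q) q≈0))) ,
  (λ p∣q → dim2 (Equivalence.from (char q) p∣q))
  where open Weights F m

-- the hypothesis n ≥ 2 is used only through n ≥ 1
theorem3p4 : (n : ℕ) → n ≥ 2 → ∃Graph (2 * n + 4) λ G →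
    ∀ {c ℓ : Level} (F : Field c ℓ) (p : ℕ) → IsCharacteristic F p →
      (¬ (p ∣ (2 * n ∸ 1)) → WcDim F G 1) × (p ∣ (2 * n ∸ 1) → WcDim F G 2)
theorem3p4 (suc m) (s≤s _) = Construction.graph m , construction-wcdim m
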